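{- Let $W$ be a set and $f:\mathcal{P}(W)^n\to\mathcal{P}(W)$. Then $f$ is completely $\overline{1}$-additive (where $\overline{1}=(1,\dots,1)$) if and only if $f$ is a complete operator, i.e.\ for every $1\le i\le n$, every family $\mathcal{X}\subseteq\mathcal{P}(W)$ and all $X_1,\dots,X_{i-1},X_{i+1},\dots,X_n\in\mathcal{P}(W)$, $f(X_1,\dots,X_{i-1},\bigcup\mathcal{X},X_{i+1},\dots,X_n)=\bigcup_{Y\in\mathcal{X}}f(X_1,\dots,X_{i-1},Y,X_{i+1},\dots,X_n)$.
   Context: For $S\subseteq W$, $S\subseteq_k X$ means $S\subseteq X$ and $|S|\le k$. For $\overline{X}\in\mathcal{P}(W)^n$ and $\overline{m}\in\mathbb{N}^n$, $\sigma_{\overline{m}}(\overline{X})=\{\overline{Z}\mid Z_i\subseteq_{m_i}X_i\text{ for all }i\}$ if all $X_i\neq\emptyset$, and $\sigma_{\overline{m}}(\overline{X})=\emptyset$ otherwise. $f$ is completely $\overline{m}$-additive if $f(\overline{X})=\bigcup\{f(\overline{Z})\mid\overline{Z}\in\sigma_{\overline{m}}(\overline{X})\}$ for all $\overline{X}$. Note that the union over the empty family $\mathcal{X}$ is $\emptyset$. -}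

module Defs where

open import Level using (0ℓ; suc)
open import Data.Nat using (ℕ; _≤_)
open import Data.Fin using (Fin)
open import Data.List using (List; length)
open import Data.List.Membership.Propositional using () renaming (_∈_ to _∈ₗ_)
open import Data.Product using (Σ; _×_; ∃; ∃-syntax)
open import Data.Vec.Functional using (Vector; updateAt)
open import Function using (const)
open import Relation.Unary using (Pred; _∈_; _⊆_; _≐_; ⋃; Satisfiable)

𝒫 : Set → Set₁
𝒫 W = Pred W 0ℓ

-- |S| ≤ k : S is covered by a list of at most k elements.
CardLe : {W : Set} → 𝒫 W → ℕ → Set
CardLe {W} S k = Σ (List W) λ xs → (length xs ≤ k) × (∀ w → w ∈ S → w ∈ₗ xs)

_⊆[_]_ : {W : Set} → 𝒫 W → ℕ → 𝒫 W → Set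
S ⊆[ k ] X = (S ⊆ X) × CardLe S k

-- Membership Z̄ ∈ σ_m̄(X̄): all X_i nonempty and Z_i ⊆_{m_i} X_i for all i
-- (if some X_i is empty, σ is empty).
σ : {W : Set} {n : ℕ} → Vector ℕ n → Vector (𝒫 W) n → Vector (𝒫 W) n → Set
σ m X Z = (∀ i → Satisfiable (X i)) × (∀ i → Z i ⊆[ m i ] X i)

⋃σ : {W : Set} {n : ℕ} → Vector ℕ n → (Vector (𝒫 W) n → 𝒫 W) → Vector (𝒫 W) n → Pred W (suc 0ℓ)
⋃σ m f X w = ∃[ Z ] (σ m X Z × w ∈ f Z)

CompletelyAdditive : {W : Set} {n : ℕ} → Vector ℕ n → (Vector (𝒫 W) n → 𝒫 W) → Set₁
CompletelyAdditive m f = ∀ X → f X ≐ ⋃σ m f X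

𝟏 : {n : ℕ} → Vector ℕ n
𝟏 _ = 1

CompleteOperator : {W : Set} {n : ℕ} → (Vector (𝒫 W) n → 𝒫 W) → Set₁
CompleteOperator {W} {n} f =
  ∀ (i : Fin n) (I : Set) (F : I → 𝒫 W) (X : Vector (𝒫 W) n) →
    f (updateAt X i (const (⋃ I F))) ≐ ⋃ I (λ j → f (updateAt X i (const (F j))))

-- f is a genuine function on P(W)^n: it respects extensional equality of subsets.
Extensional : {W : Set} {n : ℕ} → (Vector (𝒫 W) n → 𝒫 W) → Set₁
Extensional {W} {n} f = ∀ (X Y : Vector (𝒫 W) n) → (∀ i → X i ≐ Y i) → f X ≐ f Y

-- Complete 1̄-additivity says that w ∈ f X̄ exactly when w ∈ f Z̄ for some
-- choice of subsingletons Z_i ⊆ X_i (with every X_i nonempty).  If f has this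
-- form, a union in one argument can be pulled out: the Z_i lying in ⋃𝒳 is
-- nonempty (since Z̄ itself must be decomposable), so it meets, hence lies
-- in, a single member of 𝒳.  Conversely a complete operator is monotone, and
-- writing each X_i as the union of its singletons and pulling these unions out
-- one argument at a time replaces X̄ by a vector of singletons of its points.
module Submission where

open import Defs
open import Data.Nat using (ℕ; zero; suc; s≤s; z≤n)
open import Data.Product using (_×_; _,_; proj₁; proj₂; map₂; Σ; ∃-syntax)
open import Data.Vec.Functional using (Vector; updateAt; _∷_; tail)
open import Data.Vec.Functional.Properties using (updateAt-updates; updateAt-minimal; updateAt-id-local; ∷-cong)
open import Level using (Level)
open import Data.Bool using (Bool; true; false)
open import Data.Fin using (Fin; zero; suc; _≟_)
open import Data.List using ([]; [_]) renaming (_∷_ to _∷ₗ_)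
open import Data.List.Relation.Unary.Any using (here)
open import Function using (const; _∘_; id)
open import Relation.Nullary using (yes; no)
open import Relation.Binary.PropositionalEquality using (_≡_; _≢_; _≗_; refl; sym; subst)
open import Relation.Unary using (_∈_; _⊆_; _≐_; ⋃; Satisfiable; ｛_｝)
open import Relation.Unary.Properties using (≐-refl; ≐-trans)

private
  variable
    a p q : Level
    A : Set a
    n : ℕ
    W : Set

updateAt-const-pointwise : (P : Fin n → A → Set p) (X : Vector A n) (i : Fin n) {x : A} →
                           P i x → (∀ k → k ≢ i → P k (X k)) →
                           ∀ k → P k (updateAt X i (const x) k)
updateAt-const-pointwise P X i Px PX k with k ≟ i
... | yes refl = subst (P k) (sym (updateAt-updates k X)) Px
... | no k≢i  = subst (P k) (sym (updateAt-minimal k i X k≢i)) (PX k k≢i)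

-- P must respect ≗ since vectors are functions and updateAt X zero (const x)
-- is only pointwise equal to x ∷ tail X.
updateAt-saturate : (Q : Fin n → A → Set q) (P : Vector A n → Set p) →
                    (∀ {X Y} → X ≗ Y → P X → P Y) →
                    (∀ X i → P X → ∃[ x ] Q i x × P (updateAt X i (const x))) →
                    ∀ X → P X → ∃[ Y ] P Y × (∀ i → Q i (Y i))
updateAt-saturate {n = zero}  Q P resp step X PX = X , PX , λ ()
updateAt-saturate {n = suc n} Q P resp step X PX
  with x , Qx , PX₀ ← step X zero PX
  with Y , PxY , QY ← updateAt-saturate (Q ∘ suc) (P ∘ (x ∷_)) (resp ∘ ∷-cong refl)
                        (λ Y i → map₂ (map₂ (resp (∷-cong refl λ _ → refl))) ∘ step (x ∷ Y) (suc i))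
                        (tail X) (resp (∷-cong refl λ _ → refl) PX₀)
  = x ∷ Y , PxY , λ { zero → Qx ; (suc i) → QY i }

CardLe-1-unique : {S : 𝒫 W} {x y : W} → CardLe S 1 → x ∈ S → y ∈ S → x ≡ y
CardLe-1-unique ([] , _ , cover) x∈S _ with cover _ x∈S
... | ()
CardLe-1-unique (_ ∷ₗ [] , _ , cover) x∈S y∈S with cover _ x∈S | cover _ y∈S
... | here refl | here refl = refl
CardLe-1-unique (_ ∷ₗ _ ∷ₗ _ , s≤s () , _) _ _

⊆[]-⊆-trans : {S A B : 𝒫 W} {k : ℕ} → S ⊆[ k ] A → A ⊆ B → S ⊆[ k ] B
⊆[]-⊆-trans (S⊆A , card) A⊆B = A⊆B ∘ S⊆A , card

⊆[1]-meets⇒⊆[1] : {S A B : 𝒫 W} {x : W} → S ⊆[ 1 ] A → x ∈ S → x ∈ B → S ⊆[ 1 ] B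
⊆[1]-meets⇒⊆[1] (_ , card) x∈S x∈B =
  (λ y∈S → subst _ (CardLe-1-unique card x∈S y∈S) x∈B) , card

｛｝-⊆[1] : {A : 𝒫 W} {x : W} → x ∈ A → ｛ x ｝ ⊆[ 1 ] A
｛｝-⊆[1] {x = x} x∈A = (λ { refl → x∈A }) , [ x ] , s≤s z≤n , λ { _ refl → here refl }

σ-updateAt-at : {m : Vector ℕ n} {X Z : Vector (𝒫 W) n} {i : Fin n} {A : 𝒫 W} →
                σ m (updateAt X i (const A)) Z → Satisfiable A × Z i ⊆[ m i ] A
σ-updateAt-at {m = m} {X} {Z} {i} (nonempty , bounded) =
  subst Satisfiable (updateAt-updates i X) (nonempty i) ,
  subst (Z i ⊆[ m i ]_) (updateAt-updates i X) (bounded i)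

σ-updateAt-replace : {m : Vector ℕ n} {X Z : Vector (𝒫 W) n} {i : Fin n} {A B : 𝒫 W} →
                     σ m (updateAt X i (const A)) Z → Satisfiable B → Z i ⊆[ m i ] B →
                     σ m (updateAt X i (const B)) Z
σ-updateAt-replace {m = m} {X} {Z} {i} (nonempty , bounded) B≠∅ Zi⊆B =
  updateAt-const-pointwise (λ _ → Satisfiable) X i B≠∅
    (λ k k≢i → subst Satisfiable (updateAt-minimal k i X k≢i) (nonempty k)) ,
  updateAt-const-pointwise (λ k → Z k ⊆[ m k ]_) X i Zi⊆B
    (λ k k≢i → subst (Z k ⊆[ m k ]_) (updateAt-minimal k i X k≢i) (bounded k))

module _ {f : Vector (𝒫 W) n → 𝒫 W} (additive : CompletelyAdditive 𝟏 f) where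

  completelyAdditive⇒completeOperator : CompleteOperator f
  completelyAdditive⇒completeOperator i I F X = split , join
    where
    split : f (updateAt X i (const (⋃ I F))) ⊆ ⋃ I (λ j → f (updateAt X i (const (F j))))
    split w∈
      with Z , Zσ , w∈fZ ← proj₁ (additive _) w∈
      with _ , (Z≠∅ , _) , _ ← proj₁ (additive Z) w∈fZ
      with z , z∈Zi ← Z≠∅ i
      with _ , Zi⊆⋃F ← σ-updateAt-at Zσ
      with j , z∈Fj ← proj₁ Zi⊆⋃F z∈Zi
      = j , proj₂ (additive _)
              (Z , σ-updateAt-replace Zσ (z , z∈Fj) (⊆[1]-meets⇒⊆[1] Zi⊆⋃F z∈Zi z∈Fj) , w∈fZ)

    join : ⋃ I (λ j → f (updateAt X i (const (F j)))) ⊆ f (updateAt X i (const (⋃ I F)))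
    join (j , w∈)
      with Z , Zσ , w∈fZ ← proj₁ (additive _) w∈
      with (x , x∈Fj) , Zi⊆Fj ← σ-updateAt-at Zσ
      = proj₂ (additive _)
          (Z , σ-updateAt-replace Zσ (x , j , x∈Fj) (⊆[]-⊆-trans Zi⊆Fj (j ,_)) , w∈fZ)

module _ {f : Vector (𝒫 W) n → 𝒫 W} (ext : Extensional f) where

  ≗⇒f≐ : {X Y : Vector (𝒫 W) n} → X ≗ Y → f X ≐ f Y
  ≗⇒f≐ X≗Y = ext _ _ (λ k → subst (_ ≐_) (X≗Y k) ≐-refl)

  updateAt-resp-≐ : ∀ X i {A B : 𝒫 W} → A ≐ B →
                    f (updateAt X i (const A)) ≐ f (updateAt X i (const B))
  updateAt-resp-≐ X i {A} {B} A≐B = ext _ _ pointwise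
    where
    pointwise : ∀ k → updateAt X i (const A) k ≐ updateAt X i (const B) k
    pointwise k with k ≟ i
    ... | yes refl rewrite updateAt-updates k {const A} X
                         | updateAt-updates k {const B} X = A≐B
    ... | no k≢i   rewrite updateAt-minimal k i {const A} X k≢i
                         | updateAt-minimal k i {const B} X k≢i = ≐-refl

  updateAt-≐ : ∀ X i {A : 𝒫 W} → X i ≐ A → f X ≐ f (updateAt X i (const A))
  updateAt-≐ X i Xi≐A =
    ≐-trans (≗⇒f≐ (sym ∘ updateAt-id-local i X refl)) (updateAt-resp-≐ X i Xi≐A)

  module _ (complete : CompleteOperator f) where

    monotoneAt : ∀ X i {B : 𝒫 W} → X i ⊆ B → f X ⊆ f (updateAt X i (const B))
    monotoneAt X i {B} Xi⊆B w∈ =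
      proj₁ (updateAt-resp-≐ X i ⋃F≐B)
        (proj₂ (complete i Bool F X) (true , proj₁ (updateAt-≐ X i ≐-refl) w∈))
      where
      F : Bool → 𝒫 W
      F true  = X i
      F false = B

      ⋃F≐B : ⋃ Bool F ≐ B
      ⋃F≐B = (λ { (true , x∈) → Xi⊆B x∈ ; (false , x∈) → x∈ }) , (false ,_)

    singletonAt : ∀ X i {w} → w ∈ f X → ∃[ x ] x ∈ X i × w ∈ f (updateAt X i (const ｛ x ｝))
    singletonAt X i w∈ =
      let (x , x∈) , w∈′ = proj₁ (complete i (Σ W (X i)) (｛_｝ ∘ proj₁) X)
                                 (proj₁ (updateAt-≐ X i Xi≐⋃｛｝) w∈)
      in x , x∈ , w∈′
      where
      Xi≐⋃｛｝ : X i ≐ ⋃ (Σ W (X i)) (｛_｝ ∘ proj₁)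
      Xi≐⋃｛｝ = (λ x∈ → (_ , x∈) , refl) , λ { ((_ , x∈) , refl) → x∈ }

    WitnessBelow : Vector (𝒫 W) n → W → Vector (𝒫 W) n → Set
    WitnessBelow X w Y = (∀ k → Y k ⊆ X k) × w ∈ f Y

    witnessBelow-resp-≗ : ∀ {X w Y Y′} → Y ≗ Y′ → WitnessBelow X w Y → WitnessBelow X w Y′
    witnessBelow-resp-≗ {X} Y≗Y′ (Y⊆X , w∈) =
      (λ k → subst (_⊆ X k) (Y≗Y′ k) (Y⊆X k)) , proj₁ (≗⇒f≐ Y≗Y′) w∈

    updateAt-below : ∀ {X Y : Vector (𝒫 W) n} i {A} → (∀ k → Y k ⊆ X k) → A ⊆ X i →
                     ∀ k → updateAt Y i (const A) k ⊆ X k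
    updateAt-below {X} {Y} i Y⊆X A⊆Xi =
      updateAt-const-pointwise (λ k → _⊆ X k) Y i A⊆Xi (λ k _ → Y⊆X k)

    monotone : {Z X : Vector (𝒫 W) n} → (∀ i → Z i ⊆ X i) → f Z ⊆ f X
    monotone {Z} {X} Z⊆X w∈ =
      let Y , (_ , w∈fY) , Y≡X = updateAt-saturate (λ i → _≡ X i) (WitnessBelow X _)
                                    witnessBelow-resp-≗ raise Z (Z⊆X , w∈)
      in proj₁ (≗⇒f≐ Y≡X) w∈fY
      where
      raise : ∀ Y i → WitnessBelow X _ Y → ∃[ A ] A ≡ X i × WitnessBelow X _ (updateAt Y i (const A))
      raise Y i (Y⊆X , w∈) = X i , refl , updateAt-below i Y⊆X id , monotoneAt Y i (Y⊆X i) w∈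

    singletons : ∀ X {w} → w ∈ f X → ⋃σ 𝟏 f X w
    singletons X w∈ =
      let Y , (_ , w∈fY) , Y-points = updateAt-saturate IsPointOf (WitnessBelow X _)
                                         witnessBelow-resp-≗ shrink X ((λ _ → id) , w∈)
      in Y , points⇒σ Y-points , w∈fY
      where
      IsPointOf : Fin n → 𝒫 W → Set₁
      IsPointOf i A = ∃[ x ] x ∈ X i × A ≡ ｛ x ｝

      shrink : ∀ Y i → WitnessBelow X _ Y → ∃[ A ] IsPointOf i A × WitnessBelow X _ (updateAt Y i (const A))
      shrink Y i (Y⊆X , w∈) =
        let x , x∈Yi , w∈′ = singletonAt Y i w∈
        in ｛ x ｝ , (x , Y⊆X i x∈Yi , refl) ,
           updateAt-below i Y⊆X (λ { refl → Y⊆X i x∈Yi }) , w∈′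

      points⇒σ : ∀ {Y} → (∀ i → IsPointOf i (Y i)) → σ 𝟏 X Y
      points⇒σ Y-points =
        (λ i → let x , x∈ , _ = Y-points i in x , x∈) ,
        (λ i → let x , x∈ , Yi≡ = Y-points i in subst (_⊆[ 1 ] X i) (sym Yi≡) (｛｝-⊆[1] x∈))

    completeOperator⇒completelyAdditive : CompletelyAdditive 𝟏 f
    completeOperator⇒completelyAdditive X =
      singletons X , λ { (Z , (_ , Z⊆₁X) , w∈) → monotone (proj₁ ∘ Z⊆₁X) w∈ }

lemma3p8 : {W : Set} {n : ℕ} (f : Vector (𝒫 W) n → 𝒫 W) → Extensional f →
    (CompletelyAdditive 𝟏 f → CompleteOperator f) × (CompleteOperator f → CompletelyAdditive 𝟏 f)
lemma3p8 f ext = completelyAdditive⇒completeOperator , completeOperator⇒completelyAdditive ext
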